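{- Let $A$ be a finite abelian group, $B$ an abelian group, and $\psi:\wedge^3\mathbb Z[A]\to B$ a group homomorphism; write $\psi(\mathbf a{:}\mathbf b{:}\mathbf c)$ for the image of $[\mathbf a]\wedge[\mathbf b]\wedge[\mathbf c]$. Assume that $\psi(-\mathbf a{:}-\mathbf b{:}-\mathbf c)=\psi(\mathbf a{:}\mathbf b{:}\mathbf c)$ and $\psi(\mathbf a+\mathbf x{:}\mathbf b+\mathbf x{:}\mathbf c+\mathbf x)=\psi(\mathbf a{:}\mathbf b{:}\mathbf c)$ for all $\mathbf a,\mathbf b,\mathbf c,\mathbf x\in A$. Then for all $\mathbf a,\mathbf b,\mathbf c\in A$, modulo $2$-torsion in $B$, $$\sum_{\mathbf x\in A}\psi(\mathbf a{:}\mathbf b{:}\mathbf x)=\sum_{\mathbf x\in A}\psi(\mathbf a{:}\mathbf x{:}\mathbf c)=\sum_{\mathbf x\in A}\psi(\mathbf x{:}\mathbf b{:}\mathbf c)=0.$$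
   Context: $\mathbb Z[A]$ is the group ring (free abelian group on the elements $[\mathbf a]$, $\mathbf a\in A$), and $\wedge^3$ its third exterior power over $\mathbb Z$. -}

module Defs where

open import Level using (Level; _⊔_)
open import Data.Nat using (ℕ; zero; suc)
open import Data.Fin using (Fin; zero; suc)
open import Data.Product using (∃)
open import Relation.Binary.PropositionalEquality using (_≡_)
open import Algebra.Bundles using (AbelianGroup)

private
  variable
    a ℓa b ℓb : Level

record FiniteEnum (A : AbelianGroup a ℓa) : Set (a ⊔ ℓa) where
  open AbelianGroup A
  field
    size       : ℕ
    enum       : Fin size → Carrier
    surjective : ∀ x → ∃ λ i → enum i ≈ x
    injective  : ∀ i j → enum i ≈ enum j → i ≡ j

ΣFin : (B : AbelianGroup b ℓb) → ∀ {n} → (Fin n → AbelianGroup.Carrier B)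
     → AbelianGroup.Carrier B
ΣFin B {zero}  f = AbelianGroup.ε B
ΣFin B {suc n} f = AbelianGroup._∙_ B (f zero) (ΣFin B (λ i → f (suc i)))

ΣA : {A : AbelianGroup a ℓa} → FiniteEnum A → (B : AbelianGroup b ℓb)
   → (AbelianGroup.Carrier A → AbelianGroup.Carrier B) → AbelianGroup.Carrier B
ΣA F B g = ΣFin B (λ i → g (FiniteEnum.enum F i))

-- A group homomorphism  ψ : ∧³ ℤ[A] → B.
-- ℤ[A] is free abelian on the symbols [x], x ∈ A, so ∧³ ℤ[A] is the abelian
-- group generated by the symbols [x]∧[y]∧[z] subject to the alternating
-- relations; by this universal property a homomorphism out of it is exactly
-- its value  ψ(x:y:z)  on the generators, which must respect equality of
-- group elements, vanish when two arguments coincide, and change sign under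
-- transpositions.
record Hom∧³ℤ[_]⟶_ (A : AbelianGroup a ℓa) (B : AbelianGroup b ℓb)
       : Set (a ⊔ ℓa ⊔ b ⊔ ℓb) where
  private
    module A = AbelianGroup A
    module B = AbelianGroup B
  field
    ψ      : A.Carrier → A.Carrier → A.Carrier → B.Carrier
    cong   : ∀ {x x′ y y′ z z′} → x A.≈ x′ → y A.≈ y′ → z A.≈ z′
           → ψ x y z B.≈ ψ x′ y′ z′
    rep₁₂  : ∀ x z → ψ x x z B.≈ B.ε
    rep₂₃  : ∀ x y → ψ x y y B.≈ B.ε
    rep₁₃  : ∀ x y → ψ x y x B.≈ B.ε
    swap₁₂ : ∀ x y z → ψ y x z B.≈ B._⁻¹ (ψ x y z)
    swap₂₃ : ∀ x y z → ψ x z y B.≈ B._⁻¹ (ψ x y z)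

Is2Torsion : (B : AbelianGroup b ℓb) → AbelianGroup.Carrier B → Set ℓb
Is2Torsion B s = AbelianGroup._≈_ B (AbelianGroup._∙_ B s s) (AbelianGroup.ε B)

module _ {A : AbelianGroup a ℓa} {B : AbelianGroup b ℓb} (Ψ : Hom∧³ℤ[ A ]⟶ B) where
  private
    module A = AbelianGroup A
    module B = AbelianGroup B
    ψ = Hom∧³ℤ[_]⟶_.ψ Ψ

  NegInvariant : Set (a ⊔ ℓb)
  NegInvariant = ∀ x y z → ψ (x A.⁻¹) (y A.⁻¹) (z A.⁻¹) B.≈ ψ x y z

  TransInvariant : Set (a ⊔ ℓb)
  TransInvariant = ∀ x y z t → ψ (x A.∙ t) (y A.∙ t) (z A.∙ t) B.≈ ψ x y z

-- For fixed a, b the sum Σₓ ψ(a:b:x) equals its own negative: negating all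
-- three arguments and reindexing x ↦ -x gives Σₓ ψ(-a:-b:x), and translating
-- by a + b (again reindexing the sum) turns this into Σₓ ψ(b:a:x), which is
-- -Σₓ ψ(a:b:x) by antisymmetry. By antisymmetry of ψ the other two sums are,
-- up to sign, sums of the same shape.
module Submission where

open import Defs
open import Level using (Level)
open import Data.Product using (_×_; _,_; proj₁; proj₂)
open import Algebra.Bundles using (AbelianGroup)
open import Data.Nat using (zero; suc)
open import Data.Fin using (Fin; zero; suc)
open import Data.Fin.Permutation using (Permutation; permutation; _⟨$⟩ʳ_)
import Algebra.Properties.CommutativeMonoid.Sum as CommutativeMonoidSum
import Algebra.Properties.AbelianGroup as AbelianGroupProperties
import Algebra.Properties.Group as GroupProperties
import Relation.Binary.Reasoning.Setoid as SetoidReasoning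
open import Relation.Binary.PropositionalEquality as ≡ using (_≡_)

module FinSum {b ℓb : Level} (B : AbelianGroup b ℓb) where
  open AbelianGroup B
  open GroupProperties group using (ε⁻¹≈ε)
  open AbelianGroupProperties B using (⁻¹-∙-comm)
  private module Σ = CommutativeMonoidSum commutativeMonoid

  ΣFin≡sum : ∀ {n} (f : Fin n → Carrier) → ΣFin B f ≡ Σ.sum f
  ΣFin≡sum {zero}  f = ≡.refl
  ΣFin≡sum {suc n} f = ≡.cong (f zero ∙_) (ΣFin≡sum (λ i → f (suc i)))

  ΣFin-cong : ∀ {n} {f g : Fin n → Carrier} → (∀ i → f i ≈ g i) → ΣFin B f ≈ ΣFin B g
  ΣFin-cong {zero}  f≈g = refl
  ΣFin-cong {suc n} f≈g = ∙-cong (f≈g zero) (ΣFin-cong (λ i → f≈g (suc i)))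

  ΣFin-⁻¹ : ∀ {n} (f : Fin n → Carrier) → ΣFin B (λ i → f i ⁻¹) ≈ ΣFin B f ⁻¹
  ΣFin-⁻¹ {zero}  f = sym ε⁻¹≈ε
  ΣFin-⁻¹ {suc n} f = trans (∙-congˡ (ΣFin-⁻¹ (λ i → f (suc i)))) (⁻¹-∙-comm _ _)

  ΣFin-permute : ∀ {n} (f : Fin n → Carrier) (π : Permutation n n) →
                 ΣFin B (λ i → f (π ⟨$⟩ʳ i)) ≈ ΣFin B f
  ΣFin-permute f π = begin
    ΣFin B (λ i → f (π ⟨$⟩ʳ i)) ≡⟨ ΣFin≡sum (λ i → f (π ⟨$⟩ʳ i)) ⟩
    Σ.sum (λ i → f (π ⟨$⟩ʳ i))  ≈⟨ sym (Σ.sum-permute f π) ⟩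
    Σ.sum f                     ≡⟨ ≡.sym (ΣFin≡sum f) ⟩
    ΣFin B f                    ∎
    where open SetoidReasoning setoid

module FiniteGroupSum {a ℓa b ℓb : Level} {A : AbelianGroup a ℓa} (fin : FiniteEnum A)
                      (B : AbelianGroup b ℓb) where
  private
    module A = AbelianGroup A
    module B = AbelianGroup B
  open FiniteEnum fin
  open FinSum B

  ΣA-cong : {f g : A.Carrier → B.Carrier} → (∀ t → f t B.≈ g t) → ΣA fin B f B.≈ ΣA fin B g
  ΣA-cong f≈g = ΣFin-cong (λ i → f≈g (enum i))

  ΣA-⁻¹ : (f : A.Carrier → B.Carrier) → ΣA fin B (λ t → f t B.⁻¹) B.≈ ΣA fin B f B.⁻¹
  ΣA-⁻¹ f = ΣFin-⁻¹ (λ i → f (enum i))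

  ΣA-reindex : (σ τ : A.Carrier → A.Carrier) →
               (∀ {s t} → s A.≈ t → σ s A.≈ σ t) → (∀ {s t} → s A.≈ t → τ s A.≈ τ t) →
               (∀ t → σ (τ t) A.≈ t) → (∀ t → τ (σ t) A.≈ t) →
               (g : A.Carrier → B.Carrier) → (∀ {s t} → s A.≈ t → g s B.≈ g t) →
               ΣA fin B (λ t → g (σ t)) B.≈ ΣA fin B g
  ΣA-reindex σ τ σ-cong τ-cong στ≈id τσ≈id g g-cong =
    B.trans (ΣFin-cong (λ i → g-cong (A.sym (proj₂ (surjective (σ (enum i)))))))
            (ΣFin-permute (λ i → g (enum i)) (permutation (index σ) (index τ) στ τσ))
    where
    index : (A.Carrier → A.Carrier) → Fin size → Fin size
    index h i = proj₁ (surjective (h (enum i)))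

    enum-index : ∀ h i → enum (index h i) A.≈ h (enum i)
    enum-index h i = proj₂ (surjective (h (enum i)))

    στ : ∀ i → index σ (index τ i) ≡ i
    στ i = injective _ _ (A.trans (enum-index σ _)
                                  (A.trans (σ-cong (enum-index τ i)) (στ≈id _)))
    τσ : ∀ i → index τ (index σ i) ≡ i
    τσ i = injective _ _ (A.trans (enum-index τ _)
                                  (A.trans (τ-cong (enum-index σ i)) (τσ≈id _)))

  module _ (g : A.Carrier → B.Carrier) (g-cong : ∀ {s t} → s A.≈ t → g s B.≈ g t) where
    open GroupProperties A.group using (⁻¹-involutive; //-rightDividesˡ; //-rightDividesʳ)

    ΣA-inversion : ΣA fin B (λ t → g (t A.⁻¹)) B.≈ ΣA fin B g
    ΣA-inversion = ΣA-reindex A._⁻¹ A._⁻¹ A.⁻¹-cong A.⁻¹-cong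
                              ⁻¹-involutive ⁻¹-involutive g g-cong

    ΣA-translation : ∀ k → ΣA fin B (λ t → g (t A.∙ k)) B.≈ ΣA fin B g
    ΣA-translation k = ΣA-reindex (A._∙ k) (λ t → t A.∙ k A.⁻¹) A.∙-congʳ A.∙-congʳ
                                  (//-rightDividesˡ k) (//-rightDividesʳ k) g g-cong

module _ {b ℓb : Level} (B : AbelianGroup b ℓb) where
  open AbelianGroup B

  Is2Torsion-resp : ∀ {s s′} → s ≈ s′ → Is2Torsion B s → Is2Torsion B s′
  Is2Torsion-resp s≈s′ 2s≈ε = trans (∙-cong (sym s≈s′) (sym s≈s′)) 2s≈ε

  ≈⁻¹⇒Is2Torsion : ∀ {s} → s ≈ s ⁻¹ → Is2Torsion B s
  ≈⁻¹⇒Is2Torsion {s} s≈s⁻¹ = trans (∙-congˡ s≈s⁻¹) (inverseʳ s)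

module Alternating {a ℓa b ℓb : Level} {A : AbelianGroup a ℓa} {B : AbelianGroup b ℓb}
                   (Ψ : Hom∧³ℤ[ A ]⟶ B) where
  private
    module A = AbelianGroup A
    module B = AbelianGroup B
  open Hom∧³ℤ[_]⟶_ Ψ
  open GroupProperties B.group using (⁻¹-involutive)

  ψ-rotate : ∀ x y z → ψ x y z B.≈ ψ y z x
  ψ-rotate x y z = B.trans (swap₁₂ y x z)
                   (B.trans (B.⁻¹-cong (swap₂₃ y z x)) (⁻¹-involutive _))

  module Sums (fin : FiniteEnum A) where
    open FiniteGroupSum fin B

    Σψ-swap₂₃ : ∀ x z → ΣA fin B (λ t → ψ x t z) B.≈ ΣA fin B (ψ x z) B.⁻¹
    Σψ-swap₂₃ x z = B.trans (ΣA-cong (swap₂₃ x z)) (ΣA-⁻¹ (ψ x z))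

    Σψ-rotate : ∀ y z → ΣA fin B (λ t → ψ t y z) B.≈ ΣA fin B (ψ y z)
    Σψ-rotate y z = ΣA-cong (λ t → ψ-rotate t y z)

    Σψ-self-inverse : NegInvariant Ψ → TransInvariant Ψ →
                      ∀ u v → ΣA fin B (ψ u v) B.≈ ΣA fin B (ψ u v) B.⁻¹
    Σψ-self-inverse negInv transInv u v = begin
      ΣA fin B (ψ u v)
        ≈⟨ ΣA-cong (λ t → B.sym (negInv u v t)) ⟩
      ΣA fin B (λ t → ψ (u A.⁻¹) (v A.⁻¹) (t A.⁻¹))
        ≈⟨ ΣA-inversion (ψ (u A.⁻¹) (v A.⁻¹)) (cong A.refl A.refl) ⟩
      ΣA fin B (ψ (u A.⁻¹) (v A.⁻¹))
        ≈⟨ ΣA-cong (λ t → B.sym (transInv (u A.⁻¹) (v A.⁻¹) t k)) ⟩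
      ΣA fin B (λ t → ψ (u A.⁻¹ A.∙ k) (v A.⁻¹ A.∙ k) (t A.∙ k))
        ≈⟨ ΣA-cong (λ t → cong -u+k≈v -v+k≈u (A.refl {t A.∙ k})) ⟩
      ΣA fin B (λ t → ψ v u (t A.∙ k))
        ≈⟨ ΣA-translation (ψ v u) (cong A.refl A.refl) k ⟩
      ΣA fin B (ψ v u)
        ≈⟨ ΣA-cong (swap₁₂ u v) ⟩
      ΣA fin B (λ t → ψ u v t B.⁻¹)
        ≈⟨ ΣA-⁻¹ (ψ u v) ⟩
      ΣA fin B (ψ u v) B.⁻¹ ∎
      where
      open SetoidReasoning B.setoid
      open GroupProperties A.group using (\\-leftDividesʳ)
      k = u A.∙ v
      -u+k≈v : u A.⁻¹ A.∙ k A.≈ v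
      -u+k≈v = \\-leftDividesʳ u v
      -v+k≈u : v A.⁻¹ A.∙ k A.≈ u
      -v+k≈u = A.trans (A.∙-congˡ (A.comm u v)) (\\-leftDividesʳ v u)

lemma3p10 : ∀ {a ℓa b ℓb : Level}
    (A : AbelianGroup a ℓa) (fin : FiniteEnum A) (B : AbelianGroup b ℓb)
    (Ψ : Hom∧³ℤ[ A ]⟶ B) →
    NegInvariant Ψ → TransInvariant Ψ →
    ∀ x y z →
      Is2Torsion B (ΣA fin B (λ t → Hom∧³ℤ[_]⟶_.ψ Ψ x y t))
    × Is2Torsion B (ΣA fin B (λ t → Hom∧³ℤ[_]⟶_.ψ Ψ x t z))
    × Is2Torsion B (ΣA fin B (λ t → Hom∧³ℤ[_]⟶_.ψ Ψ t y z))
lemma3p10 A fin B Ψ negInv transInv x y z =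
    Σψ-2-torsion x y
  , Is2Torsion-resp B (B.trans (Σψ-self-inverse negInv transInv x z) (B.sym (Σψ-swap₂₃ x z)))
                      (Σψ-2-torsion x z)
  , Is2Torsion-resp B (B.sym (Σψ-rotate y z)) (Σψ-2-torsion y z)
  where
  module B = AbelianGroup B
  open Alternating Ψ
  open Sums fin
  Σψ-2-torsion : ∀ u v → Is2Torsion B (ΣA fin B (Hom∧³ℤ[_]⟶_.ψ Ψ u v))
  Σψ-2-torsion u v = ≈⁻¹⇒Is2Torsion B (Σψ-self-inverse negInv transInv u v)
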